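{- Let $q$ be a prime power and let $m,n,\delta$ be positive integers with $m\geq n\geq\delta$; put $k=n-\delta+1$ and assume $m\geq kn-k^2+2$. Let $\beta\in\mathbb F_{q^m}$ be such that $(1,\beta,\dots,\beta^{m-1})$ is a basis of $\mathbb F_{q^m}$ over $\mathbb F_q$. Suppose there is a $k\times n$ matrix $\mathbf G$ over $\mathbb F_{q^m}$ (rows indexed $1,\dots,k$, columns $0,\dots,n-1$) of the form: $\mathbf G_{i,j}=1$ if $j=i-1$ and $0$ if $j\le k-1$, $j\neq i-1$; $\mathbf G_{i,j}=a_{i,j}\beta^{j-i+1}$ for $k\le j\le n-2$; $\mathbf G_{1,n-1}=a_{1,n-1}\beta^{n}$ and $\mathbf G_{i,n-1}=a_{i,n-1}\beta^{n-i}$ for $2\le i\le k$; where all $a_{i,j}\in\mathbb F_q^*$, every minor of $\mathbf A_1=(a_{i,j})_{1\le i\le k,\,k\le j\le n-2}$ and of $\mathbf A_2=(a_{i,j})_{2\le i\le k,\,k\le j\le n-1}$ is nonzero, and $\mathbf G$ is a generator matrix of a systematic MRD$[m\times n,\delta]_q$ code. Then there exists an optimal $[\mathcal F,\sum_{i=0}^{k-1}\gamma_i,\delta]_q$ code for every $m'\times n$ Ferrers diagram $\mathcal F$ (with column counts $\gamma_0,\dots,\gamma_{n-1}$) satisfying (1) $\gamma_i=\min\{\max\{\gamma_l+i-l:l\in[k]\},m\}$ for every $k\leq i\leq n-2$, and (2) $m'=\min\{\max\{\gamma_0+n,\ \max\{\gamma_l+n-1-l:1\leq l\leq k-1\}\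},m\}$.
   Context: $[a]$ denotes $\{0,1,\dots,a-1\}$. Fix an ordered basis $(\beta_0,\dots,\beta_{m-1})$ of $\mathbb F_{q^m}$ over $\mathbb F_q$ and let $\Psi_m:\mathbb F_{q^m}^n\to\mathbb F_q^{m\times n}$ send $(a_0,\dots,a_{n-1})$ to the matrix $A$ with $a_j=\sum_i A_{i,j}\beta_i$; the rank of a vector is the rank of its image. A $k\times n$ matrix $\mathbf G$ over $\mathbb F_{q^m}$ ($m\ge n$) of rank $k$ generates the $\mathbb F_{q^m}$-linear code $\{\mathbf u\mathbf G:\mathbf u\in\mathbb F_{q^m}^k\}$; it generates an MRD$[m\times n,\delta]_q$ code if $k=n-\delta+1$ and every nonzero codeword has rank at least $\delta$; it is systematic if $\mathbf G=(\mathbf I_k\mid\mathbf A)$. An $m\times n$ Ferrers diagram is a set $\mathcal F\subseteq[m]\times[n]$ such that: if $(i,j)\in\mathcal F$, $i\ge1$ then $(i-1,j)\in\mathcal F$; if $(i,j)\in\mathcal F$, $j\le n-2$ then $(i,j+1)\in\mathcal F$; row $0$ has $n$ dots and column $n-1$ has $m$ dots. $\gamma_j$ is the number of dots in column $j$. An $[\mathcal F,k,\delta]_q$ code is a $k$-dimensional $\mathbb F_q$-subspace of $\mathbb F_q^{m\times n}$ whose matrices vanish outside $\mathcal F$ and whose nonzero matrices have rank at least $\delta$; it is optimal if $k=\min_{i\in[\delta]}v_i$, with $v_i$ the number of dots of $\mathcal F$ not in the first $i$ rows and not in the rightmost $\delta-1-i$ columns. -}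

module Defs where

open import Data.Nat as ℕ using (ℕ; zero; suc; _≤_; _<_; _∸_; _⊔_; _⊓_; _≤?_; _<?_)
open import Data.Nat.Primality using (Prime)
open import Data.Fin using (Fin; zero; suc; toℕ; punchIn)
open import Data.Bool using (Bool; true; false; _∧_; if_then_else_)
open import Data.Product using (Σ; _×_; _,_)
open import Relation.Binary.PropositionalEquality using (_≡_)
open import Relation.Nullary using (¬_; Dec)
open import Relation.Nullary.Decidable using (⌊_⌋)
open import Function.Bundles using (_↔_)

record Field : Set₁ where
  infixl 6 _+_
  infixl 7 _*_
  field
    Carrier     : Set
    _≟_         : (x y : Carrier) → Dec (x ≡ y)
    0# 1#       : Carrier
    _+_ _*_     : Carrier → Carrier → Carrier
    -_          : Carrier → Carrier
    +-assoc     : ∀ x y z → (x + y) + z ≡ x + (y + z)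
    +-comm      : ∀ x y → x + y ≡ y + x
    +-identityˡ : ∀ x → 0# + x ≡ x
    -‿inverseˡ  : ∀ x → (- x) + x ≡ 0#
    *-assoc     : ∀ x y z → (x * y) * z ≡ x * (y * z)
    *-comm      : ∀ x y → x * y ≡ y * x
    *-identityˡ : ∀ x → 1# * x ≡ x
    distribʳ    : ∀ x y z → (y + z) * x ≡ y * x + z * x
    0≢1         : ¬ (0# ≡ 1#)
    *-inverse   : ∀ x → ¬ (x ≡ 0#) → Σ Carrier (λ y → y * x ≡ 1#)

HasCardinality : Field → ℕ → Set
HasCardinality K q = Field.Carrier K ↔ Fin q

IsPrimePower : ℕ → Set
IsPrimePower q = Σ ℕ (λ p → Σ ℕ (λ e → Prime p × q ≡ p ℕ.^ suc e))

record Embedding (K L : Field) : Set where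
  private
    module K = Field K
    module L = Field L
  field
    ι   : K.Carrier → L.Carrier
    ι-0 : ι K.0# ≡ L.0#
    ι-1 : ι K.1# ≡ L.1#
    ι-+ : ∀ x y → ι (x K.+ y) ≡ ι x L.+ ι y
    ι-* : ∀ x y → ι (x K.* y) ≡ ι x L.* ι y

sumUpTo : (ℕ → ℕ) → ℕ → ℕ
sumUpTo f zero    = 0
sumUpTo f (suc k) = sumUpTo f k ℕ.+ f k

maxUpTo : (ℕ → ℕ) → ℕ → ℕ
maxUpTo f zero    = 0
maxUpTo f (suc k) = maxUpTo f k ⊔ f k

-- min_{i<k} f i  (meaningful for k ≥ 1; 0 for k = 0)
minUpTo : (ℕ → ℕ) → ℕ → ℕ
minUpTo f zero          = 0
minUpTo f (suc zero)    = f 0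
minUpTo f (suc (suc k)) = minUpTo f (suc k) ⊓ f (suc k)

count : ∀ {m} → (Fin m → Bool) → ℕ
count {zero}  P = 0
count {suc m} P = (if P zero then 1 else 0) ℕ.+ count (λ i → P (suc i))

StrictlyIncreasing : ∀ {s r} → (Fin s → Fin r) → Set
StrictlyIncreasing f = ∀ x y → toℕ x < toℕ y → toℕ (f x) < toℕ (f y)

Matrix : Field → ℕ → ℕ → Set
Matrix F m n = Fin m → Fin n → Field.Carrier F

module LinAlg (F : Field) where
  open Field F

  ∑ : ∀ {n} → (Fin n → Carrier) → Carrier
  ∑ {zero}  f = 0#
  ∑ {suc n} f = f zero + ∑ (λ i → f (suc i))

  pow : Carrier → ℕ → Carrier
  pow x zero    = 1#
  pow x (suc i) = x * pow x i

  sign : ℕ → Carrier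
  sign zero    = 1#
  sign (suc i) = - sign i

  det : ∀ {s} → Matrix F s s → Carrier
  det {zero}  M = 1#
  det {suc s} M = ∑ (λ j → sign (toℕ j) * (M zero j * det (λ x y → M (suc x) (punchIn j y))))

  LinIndepCols : ∀ {m n r} → Matrix F m n → (Fin r → Fin n) → Set
  LinIndepCols {m} {n} {r} M cols =
    (c : Fin r → Carrier) → (∀ i → ∑ (λ l → c l * M i (cols l)) ≡ 0#) → ∀ l → c l ≡ 0#

  RankAtLeast : ∀ {m n} → Matrix F m n → ℕ → Set
  RankAtLeast {m} {n} M r = Σ (Fin r → Fin n) (λ cols → LinIndepCols M cols)

  IsZeroMatrix : ∀ {m n} → Matrix F m n → Set
  IsZeroMatrix M = ∀ i j → M i j ≡ 0#

  combo : ∀ {k m n} → (Fin k → Carrier) → (Fin k → Matrix F m n) → Matrix F m n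
  combo c B i j = ∑ (λ l → c l * B l i j)

IsFerrers : ∀ {m' n} → (Fin m' → Fin n → Bool) → Set
IsFerrers {m'} {n} D =
    (∀ i i' j → suc (toℕ i') ≡ toℕ i → D i j ≡ true → D i' j ≡ true)
  × (∀ i j j' → toℕ j' ≡ suc (toℕ j) → D i j ≡ true → D i j' ≡ true)
  × (∀ i j → toℕ i ≡ 0 → D i j ≡ true)
  × (∀ i j → suc (toℕ j) ≡ n → D i j ≡ true)

countDots : ∀ {m' n} → (Fin m' → Fin n → Bool) → (Fin m' → Fin n → Bool) → ℕ
countDots {zero}   D P = 0
countDots {suc m'} D P = count (λ c → D zero c ∧ P zero c)
                         ℕ.+ countDots (λ r c → D (suc r) c) (λ r c → P (suc r) c)

γ : ∀ {m' n} → (Fin m' → Fin n → Bool) → ℕ → ℕ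
γ D j = countDots D (λ r c → ⌊ toℕ c ℕ.≟ j ⌋)

v : ∀ {m' n} → (Fin m' → Fin n → Bool) → ℕ → ℕ → ℕ
v {m'} {n} D δ i = countDots D (λ r c → ⌊ i ≤? toℕ r ⌋ ∧ ⌊ toℕ c <? n ∸ (δ ∸ 1 ∸ i) ⌋)

module _ (K : Field) where
  open Field K
  open LinAlg K

  -- An [F , dim , δ]_q code, given by a basis B_0, …, B_{dim-1} of the subspace:
  -- the B_l are linearly independent, vanish outside D, and every nonzero
  -- element of their span has rank ≥ δ.
  record FerrersCode {m' n} (D : Fin m' → Fin n → Bool) (dim δ : ℕ) : Set where
    field
      basis      : Fin dim → Matrix K m' n
      support    : ∀ l r c → D r c ≡ false → basis l r c ≡ 0#
      linIndep   : (c : Fin dim → Carrier) → IsZeroMatrix (combo c basis) → ∀ l → c l ≡ 0#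
      minRank    : (c : Fin dim → Carrier) → ¬ IsZeroMatrix (combo c basis) →
                   RankAtLeast (combo c basis) δ

  IsOptimal : ∀ {m' n} → (Fin m' → Fin n → Bool) → ℕ → ℕ → Set
  IsOptimal D dim δ = dim ≡ minUpTo (v D δ) δ

module Ext (K L : Field) (E : Embedding K L) where
  private
    module K = Field K
    module L = Field L
    module KA = LinAlg K
    module LA = LinAlg L
  open Embedding E

  IsPowerBasis : L.Carrier → ℕ → Set
  IsPowerBasis β m =
      ((c : Fin m → K.Carrier) → LA.∑ (λ i → ι (c i) L.* LA.pow β (toℕ i)) ≡ L.0# →
         ∀ i → c i ≡ K.0#)
    × ((x : L.Carrier) → Σ (Fin m → K.Carrier)
         (λ c → x ≡ LA.∑ (λ i → ι (c i) L.* LA.pow β (toℕ i))))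

  IsΨ : ∀ {m n} → L.Carrier → Matrix K m n → (Fin n → L.Carrier) → Set
  IsΨ {m} {n} β A a = ∀ j → a j ≡ LA.∑ (λ i → ι (A i j) L.* LA.pow β (toℕ i))

  VecRankAtLeast : (m : ℕ) → L.Carrier → ∀ {n} → (Fin n → L.Carrier) → ℕ → Set
  VecRankAtLeast m β {n} a δ = Σ (Matrix K m n) (λ A → IsΨ β A a × KA.RankAtLeast A δ)

  codeword : ∀ {k n} → (Fin k → L.Carrier) → Matrix L k n → Fin n → L.Carrier
  codeword u G j = LA.∑ (λ i → u i L.* G i j)

  IsMRDGenerator : (m : ℕ) → L.Carrier → ∀ {k n} → Matrix L k n → ℕ → Set
  IsMRDGenerator m β {k} {n} G δ =
      ((u : Fin k → L.Carrier) → (∀ j → codeword u G j ≡ L.0#) → ∀ i → u i ≡ L.0#)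
    × k ≡ n ∸ δ ℕ.+ 1
    × ((u : Fin k → L.Carrier) → ¬ (∀ j → codeword u G j ≡ L.0#) →
         VecRankAtLeast m β (codeword u G) δ)

  IsSystematic : ∀ {k n} → Matrix L k n → Set
  IsSystematic {k} {n} G = ∀ i j → toℕ j < k →
      (toℕ j ≡ toℕ i → G i j ≡ L.1#) × (¬ toℕ j ≡ toℕ i → G i j ≡ L.0#)

  -- The special form of G in the theorem.  Row i : Fin k stands for row i+1 of the paper.
  HasSpecialForm : L.Carrier → ∀ {k n} → Matrix L k n → (Fin k → Fin n → K.Carrier) → Set
  HasSpecialForm β {k} {n} G a =
      (∀ i j → toℕ j < k →
         (toℕ j ≡ toℕ i → G i j ≡ L.1#) × (¬ toℕ j ≡ toℕ i → G i j ≡ L.0#))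
    × (∀ i j → k ≤ toℕ j → suc (toℕ j) < n →
         G i j ≡ ι (a i j) L.* LA.pow β (toℕ j ∸ toℕ i))
    × (∀ i j → suc (toℕ j) ≡ n → toℕ i ≡ 0 →
         G i j ≡ ι (a i j) L.* LA.pow β n)
    × (∀ i j → suc (toℕ j) ≡ n → 1 ≤ toℕ i →
         G i j ≡ ι (a i j) L.* LA.pow β (n ∸ 1 ∸ toℕ i))

  CoeffConditions : ∀ {k n} → (Fin k → Fin n → K.Carrier) → Set
  CoeffConditions {k} {n} a =
      (∀ i j → k ≤ toℕ j → ¬ a i j ≡ K.0#)
      -- every minor of A₁ = (a_{i,j})_{1 ≤ i ≤ k, k ≤ j ≤ n-2} is nonzero
    × (∀ s (rs : Fin s → Fin k) (cs : Fin s → Fin n) →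
         StrictlyIncreasing rs → StrictlyIncreasing cs →
         (∀ x → k ≤ toℕ (cs x) × suc (toℕ (cs x)) < n) →
         ¬ KA.det (λ x y → a (rs x) (cs y)) ≡ K.0#)
      -- every minor of A₂ = (a_{i,j})_{2 ≤ i ≤ k, k ≤ j ≤ n-1} is nonzero
    × (∀ s (rs : Fin s → Fin k) (cs : Fin s → Fin n) →
         StrictlyIncreasing rs → StrictlyIncreasing cs →
         (∀ x → 1 ≤ toℕ (rs x)) →
         (∀ x → k ≤ toℕ (cs x)) →
         ¬ KA.det (λ x y → a (rs x) (cs y)) ≡ K.0#)

-- The code is spanned, over F_q, by the vectors β^t · G_i for i < k and t < γ_i, read as
-- m × n matrices through the power basis and cut down to the first m′ rows.  Because G is
-- systematic, β^t · G_i has a single 1 at (t , i) among the first k columns, so these Σ γ_i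
-- matrices are independent; they lie in the F_{q^m}-span of G, so every nonzero combination has
-- rank at least δ, and rows ≥ m′ vanish, so dropping them keeps the rank.  Each entry of G_i
-- outside the systematic part is a monomial a β^e, and conditions (1) and (2) guarantee
-- (γ_i + e) ⊓ m ≤ γ_j: multiplying by β^t with t < γ_i stays inside the dots of column j.
--
-- For optimality, v_i = Σ_{j < k+i} (γ_j ∸ i).  Writing γ_l = (γ_l ∸ i) + (γ_l ⊓ i) for l < k
-- and counting γ_l ⊓ i = #{s < i : i-1-s < γ_l} row by row, the growth γ_{k+s} ≥ (γ_l + k+s-l) ⊓ m
-- bounds the s-th count by γ_{k+s} ∸ i, so v_0 ≤ v_i and the minimum is v_0 = Σ_{l<k} γ_l.
--
-- The hypotheses on q, on the minors of A_1, A_2 and the bound m ≥ kn - k² + 2 serve in the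
-- paper only to make G an MRD generator; that is assumed here.

module Submission where

open import Defs
open import Algebra.Bundles using (CommutativeMonoid; CommutativeRing)
open import Algebra.Structures using (IsCommutativeRing)
open import Algebra.Consequences.Propositional using (comm∧idˡ⇒id; comm∧invˡ⇒inv; comm∧distrʳ⇒distrˡ)
import Algebra.Properties.Group as GroupProperties
import Algebra.Properties.Semiring.Sum as SemiringSum
open import Level using (0ℓ)
import Algebra.Properties.CommutativeMonoid.Sum as CommutativeMonoidSum
open import Data.Bool using (Bool; true; false; _∧_; if_then_else_)
open import Data.Bool.Properties using (∧-zeroʳ; ∧-identityʳ)
open import Data.Fin as Fin using (Fin; zero; suc; toℕ; fromℕ<; fromℕ; inject₁; inject≤; splitAt; _↑ˡ_; _↑ʳ_)
open import Data.Fin.Properties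
  using (toℕ-injective; toℕ-fromℕ<; toℕ-inject₁; toℕ-fromℕ; toℕ<n; toℕ-inject≤; splitAt⁻¹-↑ˡ; splitAt⁻¹-↑ʳ; punchInᵢ≢i)
open import Data.Nat using (ℕ; zero; suc; _≤_; _<?_)
open import Data.Nat.Properties using (≮⇒≥)
open import Data.Product using (Σ; _×_; _,_; proj₁; proj₂)
open import Data.Sum using (inj₁; inj₂; [_,_]′)
open import Function.Base using (_∘_)
open import Relation.Binary.PropositionalEquality
  using (_≡_; _≢_; ≢-sym; refl; sym; trans; cong; cong₂; subst; subst₂; isEquivalence; module ≡-Reasoning)
open import Relation.Nullary using (¬_; Dec; yes; no; contradiction)
open import Relation.Nullary.Decidable using (⌊_⌋; isYes≗does; dec-true; dec-false; does-⇔)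
open import Function.Bundles using (_⇔_; mk⇔)

⌊⌋-true : ∀ {a} {A : Set a} (a? : Dec A) → A → ⌊ a? ⌋ ≡ true
⌊⌋-true a? a = trans (isYes≗does a?) (dec-true a? a)

⌊⌋-false : ∀ {a} {A : Set a} (a? : Dec A) → ¬ A → ⌊ a? ⌋ ≡ false
⌊⌋-false a? ¬a = trans (isYes≗does a?) (dec-false a? ¬a)

⌊⌋-⇔ : ∀ {a b} {A : Set a} {B : Set b} → A ⇔ B → (a? : Dec A) (b? : Dec B) → ⌊ a? ⌋ ≡ ⌊ b? ⌋
⌊⌋-⇔ A⇔B a? b? = trans (isYes≗does a?) (trans (does-⇔ A⇔B a? b?) (sym (isYes≗does b?)))

⌊⌋-true⁻¹ : ∀ {a} {A : Set a} (a? : Dec A) → ⌊ a? ⌋ ≡ true → A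
⌊⌋-true⁻¹ (yes a) _ = a

module SumSingle {a ℓ} (M : CommutativeMonoid a ℓ) where
  open CommutativeMonoid M
  open CommutativeMonoidSum M using (sum; sum-remove; sum-cong-≋; sum-replicate-zero)
  open import Relation.Binary.Reasoning.Setoid setoid

  sum-single : ∀ {n} (f : Fin n → Carrier) i → (∀ j → j ≢ i → f j ≈ ε) → sum f ≈ f i
  sum-single {suc n} f i others = begin
    sum f                            ≈⟨ sum-remove f ⟩
    f i ∙ sum {n} (f ∘ Fin.punchIn i) ≈⟨ ∙-congˡ (sum-cong-≋ (λ j → others _ (punchInᵢ≢i i j))) ⟩
    f i ∙ sum {n} (λ _ → ε)           ≈⟨ ∙-congˡ (sum-replicate-zero n) ⟩
    f i ∙ ε                          ≈⟨ identityʳ (f i) ⟩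
    f i                              ∎

module FieldProperties (F : Field) where
  open Field F
  open LinAlg F using (∑)

  isCommutativeRing : IsCommutativeRing _≡_ _+_ _*_ -_ 0# 1#
  isCommutativeRing = record
    { isRing = record
      { +-isAbelianGroup = record
        { isGroup = record
          { isMonoid = record
            { isSemigroup = record
              { isMagma = record { isEquivalence = isEquivalence ; ∙-cong = cong₂ _+_ }
              ; assoc   = +-assoc }
            ; identity = comm∧idˡ⇒id +-comm +-identityˡ }
          ; inverse = comm∧invˡ⇒inv +-comm -‿inverseˡ
          ; ⁻¹-cong = cong -_ }
        ; comm = +-comm }
      ; *-cong     = cong₂ _*_
      ; *-assoc    = *-assoc
      ; *-identity = comm∧idˡ⇒id *-comm *-identityˡ
      ; distrib    = comm∧distrʳ⇒distrˡ *-comm distribʳ , distribʳ }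
    ; *-comm = *-comm }

  commutativeRing : CommutativeRing 0ℓ 0ℓ
  commutativeRing = record { isCommutativeRing = isCommutativeRing }

  open CommutativeRing commutativeRing public using (+-identityʳ; *-identityʳ; zeroˡ; zeroʳ)
  open GroupProperties (CommutativeRing.+-group commutativeRing) public using ()
    renaming (x∙y⁻¹≈ε⇒x≈y to x-y≡0⇒x≡y; ∙-cancelʳ to +-cancelʳ)
  private
    module Sum = SemiringSum (CommutativeRing.semiring commutativeRing)

  ∑≡sum : ∀ {n} (f : Fin n → Carrier) → ∑ f ≡ Sum.sum f
  ∑≡sum {zero}  f = refl
  ∑≡sum {suc n} f = cong (f zero +_) (∑≡sum (f ∘ suc))

  ∑-cong : ∀ {n} {f g : Fin n → Carrier} → (∀ i → f i ≡ g i) → ∑ f ≡ ∑ g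
  ∑-cong {f = f} {g} f≡g = trans (∑≡sum f) (trans (Sum.sum-cong-≗ f≡g) (sym (∑≡sum g)))

  ∑-zero : ∀ {n} (f : Fin n → Carrier) → (∀ i → f i ≡ 0#) → ∑ f ≡ 0#
  ∑-zero {n} f f≡0 = trans (∑-cong f≡0) (trans (∑≡sum {n} (λ _ → 0#)) (Sum.sum-replicate-zero n))

  ∑-single : ∀ {n} (f : Fin n → Carrier) i → (∀ j → j ≢ i → f j ≡ 0#) → ∑ f ≡ f i
  ∑-single f i others = trans (∑≡sum f) (sum-single f i others)
    where open SumSingle (CommutativeRing.+-commutativeMonoid commutativeRing)

  ∑-+ : ∀ {n} (f g : Fin n → Carrier) → ∑ (λ i → f i + g i) ≡ ∑ f + ∑ g
  ∑-+ f g = trans (∑≡sum (λ i → f i + g i)) (trans (Sum.∑-distrib-+ f g) (sym (cong₂ _+_ (∑≡sum f) (∑≡sum g))))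

  ∑-*ˡ : ∀ {n} x (f : Fin n → Carrier) → x * ∑ f ≡ ∑ (λ i → x * f i)
  ∑-*ˡ x f = trans (cong (x *_) (∑≡sum f)) (trans (Sum.*-distribˡ-sum x f) (sym (∑≡sum (λ i → x * f i))))

  ∑-*ʳ : ∀ {n} x (f : Fin n → Carrier) → ∑ f * x ≡ ∑ (λ i → f i * x)
  ∑-*ʳ x f = trans (cong (_* x) (∑≡sum f)) (trans (Sum.*-distribʳ-sum x f) (sym (∑≡sum (λ i → f i * x))))

  ∑-comm : ∀ {a b} (M : Fin a → Fin b → Carrier) → ∑ (λ i → ∑ (M i)) ≡ ∑ (λ j → ∑ (λ i → M i j))
  ∑-comm {a} {b} M = begin
    ∑ (λ i → ∑ (M i))                   ≡⟨ ∑≡sum² M ⟩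
    Sum.sum (λ i → Sum.sum (M i))           ≡⟨ Sum.∑-comm M ⟩
    Sum.sum (λ j → Sum.sum (λ i → M i j))   ≡⟨ ∑≡sum² (λ j i → M i j) ⟨
    ∑ (λ j → ∑ (λ i → M i j))           ∎
    where
    open ≡-Reasoning
    ∑≡sum² : ∀ {a b} (N : Fin a → Fin b → Carrier) → ∑ (λ i → ∑ (N i)) ≡ Sum.sum (λ i → Sum.sum (N i))
    ∑≡sum² {a} N = trans (∑≡sum (λ i → ∑ (N i))) (Sum.sum-cong-≗ {a} (∑≡sum ∘ N))

module _ (F : Field) where
  open Field F using (0#; _*_)
  open FieldProperties F using (∑-cong; ∑-zero; zeroʳ)
  open LinAlg F

  rankAtLeast-dropZeroRows : ∀ {m m′ n r} (A : Matrix F m n) (B : Matrix F m′ n) (m′≤m : m′ ≤ m) →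
    (∀ i j → B i j ≡ A (inject≤ i m′≤m) j) → (∀ i j → m′ ≤ toℕ i → A i j ≡ 0#) →
    RankAtLeast A r → RankAtLeast B r
  rankAtLeast-dropZeroRows {m′ = m′} A B m′≤m B≡A zeroRows (cols , independent) =
    cols , λ c onB → independent c (onA c onB)
    where
    onA : ∀ c → (∀ i → ∑ (λ l → c l * B i (cols l)) ≡ 0#) → ∀ i → ∑ (λ l → c l * A i (cols l)) ≡ 0#
    onA c onB i with toℕ i <? m′
    ... | yes i<m′ =
      trans (∑-cong (λ l → cong (c l *_) (trans (cong (λ i → A i (cols l)) i≡) (sym (B≡A _ (cols l)))))) (onB (fromℕ< i<m′))
      where
      i≡ : i ≡ inject≤ (fromℕ< i<m′) m′≤m
      i≡ = toℕ-injective (sym (trans (toℕ-inject≤ _ m′≤m) (toℕ-fromℕ< i<m′)))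
    ... | no  i≮m′ = ∑-zero _ (λ l → trans (cong (c l *_) (zeroRows i (cols l) (≮⇒≥ i≮m′))) (zeroʳ (c l)))

-- Opened only here: the operator and law names of Data.Nat clash with those of the Field record.
open import Data.Nat using (_+_; _*_; _∸_; _<_; _⊓_; _⊔_; _≤?_; _≟_; z≤n; s≤s; s≤s⁻¹; z<s; s<s; s<s⁻¹)
open import Data.Nat.Properties
open import Algebra.Properties.CommutativeSemigroup +-commutativeSemigroup using ()
  renaming (interchange to +-interchange; x∙yz≈y∙xz to +-exchangeˡ)

module ℕΣ = CommutativeMonoidSum +-0-commutativeMonoid
open SumSingle +-0-commutativeMonoid renaming (sum-single to ℕΣ-sum-single)

indicator : Bool → ℕ
indicator b = if b then 1 else 0

sumUpTo-cong : ∀ {f g : ℕ → ℕ} n → (∀ j → j < n → f j ≡ g j) → sumUpTo f n ≡ sumUpTo g n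
sumUpTo-cong zero    f≡g = refl
sumUpTo-cong (suc n) f≡g = cong₂ _+_ (sumUpTo-cong n (λ j j<n → f≡g j (m<n⇒m<1+n j<n))) (f≡g n ≤-refl)

sumUpTo-mono-≤ : ∀ {f g : ℕ → ℕ} n → (∀ j → j < n → f j ≤ g j) → sumUpTo f n ≤ sumUpTo g n
sumUpTo-mono-≤ zero    f≤g = z≤n
sumUpTo-mono-≤ (suc n) f≤g = +-mono-≤ (sumUpTo-mono-≤ n (λ j j<n → f≤g j (m<n⇒m<1+n j<n))) (f≤g n ≤-refl)

sumUpTo-zero : ∀ (f : ℕ → ℕ) n → (∀ j → j < n → f j ≡ 0) → sumUpTo f n ≡ 0
sumUpTo-zero f zero    f≡0 = refl
sumUpTo-zero f (suc n) f≡0 =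
  cong₂ _+_ (sumUpTo-zero f n (λ j j<n → f≡0 j (m<n⇒m<1+n j<n))) (f≡0 n ≤-refl)

sumUpTo-+ : ∀ (f g : ℕ → ℕ) n → sumUpTo (λ j → f j + g j) n ≡ sumUpTo f n + sumUpTo g n
sumUpTo-+ f g zero    = refl
sumUpTo-+ f g (suc n) rewrite sumUpTo-+ f g n = +-interchange (sumUpTo f n) (sumUpTo g n) (f n) (g n)

sumUpTo-comm : ∀ (f : ℕ → ℕ → ℕ) a b →
  sumUpTo (λ i → sumUpTo (f i) b) a ≡ sumUpTo (λ j → sumUpTo (λ i → f i j) a) b
sumUpTo-comm f zero    b = sym (sumUpTo-zero _ b (λ _ _ → refl))
sumUpTo-comm f (suc a) b rewrite sumUpTo-comm f a b = sym (sumUpTo-+ _ (f a) b)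

sumUpTo-split : ∀ (f : ℕ → ℕ) a b → sumUpTo f (a + b) ≡ sumUpTo f a + sumUpTo (λ j → f (a + j)) b
sumUpTo-split f a zero    rewrite +-identityʳ a = sym (+-identityʳ _)
sumUpTo-split f a (suc b) rewrite +-suc a b | sumUpTo-split f a b = +-assoc (sumUpTo f a) _ _

sumUpTo-restrict : ∀ (f : ℕ → ℕ) {a b} → a ≤ b →
  sumUpTo (λ j → if ⌊ j <? a ⌋ then f j else 0) b ≡ sumUpTo f a
sumUpTo-restrict f {a} {b} a≤b = begin
  sumUpTo f′ b                                       ≡⟨ cong (sumUpTo f′) (sym (m+[n∸m]≡n a≤b)) ⟩
  sumUpTo f′ (a + (b ∸ a))                           ≡⟨ sumUpTo-split f′ a (b ∸ a) ⟩
  sumUpTo f′ a + sumUpTo (λ j → f′ (a + j)) (b ∸ a)  ≡⟨ cong₂ _+_ (sumUpTo-cong a inside) (sumUpTo-zero _ (b ∸ a) outside) ⟩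
  sumUpTo f a + 0                                    ≡⟨ +-identityʳ _ ⟩
  sumUpTo f a                                        ∎
  where
  open ≡-Reasoning
  f′ : ℕ → ℕ
  f′ j = if ⌊ j <? a ⌋ then f j else 0
  inside : ∀ j → j < a → f′ j ≡ f j
  inside j j<a = cong (if_then f j else 0) (⌊⌋-true (j <? a) j<a)
  outside : ∀ j → j < b ∸ a → f′ (a + j) ≡ 0
  outside j _ = cong (if_then f (a + j) else 0) (⌊⌋-false (a + j <? a) (m+n≮m a j))

sumUpTo≡sum : ∀ (f : ℕ → ℕ) n → sumUpTo f n ≡ ℕΣ.sum {n} (f ∘ toℕ)
sumUpTo≡sum f zero    = refl
sumUpTo≡sum f (suc n) = begin
  sumUpTo f n + f n                                   ≡⟨ cong (_+ f n) (sumUpTo≡sum f n) ⟩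
  ℕΣ.sum {n} (f ∘ toℕ) + f n                         ≡⟨ cong₂ _+_ (ℕΣ.sum-cong-≗ {n} (cong f ∘ sym ∘ toℕ-inject₁))
                                                                   (cong f (sym (toℕ-fromℕ n))) ⟩
  ℕΣ.sum {n} (f ∘ toℕ ∘ inject₁) + f (toℕ (fromℕ n)) ≡⟨ sym (ℕΣ.sum-init-last (f ∘ toℕ)) ⟩
  ℕΣ.sum {suc n} (f ∘ toℕ)                           ∎
  where open ≡-Reasoning

count≡sum : ∀ {m} (P : Fin m → Bool) → count P ≡ ℕΣ.sum (indicator ∘ P)
count≡sum {zero}  P = refl
count≡sum {suc m} P = cong (indicator (P zero) +_) (count≡sum (P ∘ suc))

count-cong : ∀ {m} {P Q : Fin m → Bool} → (∀ i → P i ≡ Q i) → count P ≡ count Q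
count-cong {zero}  P≡Q = refl
count-cong {suc m} P≡Q = cong₂ _+_ (cong indicator (P≡Q zero)) (count-cong (P≡Q ∘ suc))

count-false : ∀ {m} (P : Fin m → Bool) → (∀ i → P i ≡ false) → count P ≡ 0
count-false {zero}  P P≡false = refl
count-false {suc m} P P≡false rewrite P≡false zero = count-false (P ∘ suc) (P≡false ∘ suc)

count-true : ∀ {m} (P : Fin m → Bool) → (∀ i → P i ≡ true) → count P ≡ m
count-true {zero}  P P≡true = refl
count-true {suc m} P P≡true rewrite P≡true zero = cong suc (count-true (P ∘ suc) (P≡true ∘ suc))

count≤ : ∀ {m} (P : Fin m → Bool) → count P ≤ m
count≤ {zero}  P = z≤n
count≤ {suc m} P with P zero
... | true  = s≤s (count≤ (P ∘ suc))
... | false = m≤n⇒m≤1+n (count≤ (P ∘ suc))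

count-interval : ∀ {m} a b → b ≤ m → count {m} (λ r → ⌊ toℕ r <? b ⌋ ∧ ⌊ a ≤? toℕ r ⌋) ≡ b ∸ a
count-interval {m} a zero _ =
  trans (count-false {m} _ (λ r → cong (_∧ ⌊ a ≤? toℕ r ⌋) (⌊⌋-false (toℕ r <? 0) λ ()))) (sym (0∸n≡0 a))
count-interval {suc m} zero (suc b) (s≤s b≤m) =
  cong suc (trans (count-cong {m} shift) (count-interval zero b b≤m))
  where
  shift : ∀ r → ⌊ suc (toℕ r) <? suc b ⌋ ∧ ⌊ 0 ≤? suc (toℕ r) ⌋ ≡ ⌊ toℕ r <? b ⌋ ∧ ⌊ 0 ≤? toℕ r ⌋
  shift r = cong₂ _∧_ (⌊⌋-⇔ (mk⇔ s<s⁻¹ s<s) (suc (toℕ r) <? suc b) (toℕ r <? b))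
                      (trans (⌊⌋-true (0 ≤? suc (toℕ r)) z≤n) (sym (⌊⌋-true (0 ≤? toℕ r) z≤n)))
count-interval {suc m} (suc a) (suc b) (s≤s b≤m) =
  trans (cong₂ _+_ (cong indicator (∧-zeroʳ ⌊ 0 <? suc b ⌋)) (count-cong {m} shift)) (count-interval a b b≤m)
  where
  shift : ∀ r → ⌊ suc (toℕ r) <? suc b ⌋ ∧ ⌊ suc a ≤? suc (toℕ r) ⌋ ≡ ⌊ toℕ r <? b ⌋ ∧ ⌊ a ≤? toℕ r ⌋
  shift r = cong₂ _∧_ (⌊⌋-⇔ (mk⇔ s<s⁻¹ s<s) (suc (toℕ r) <? suc b) (toℕ r <? b))
                      (⌊⌋-⇔ (mk⇔ s≤s⁻¹ s≤s) (suc a ≤? suc (toℕ r)) (a ≤? toℕ r))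

DownClosed : ∀ {m} → (Fin m → Bool) → Set
DownClosed P = ∀ r r′ → suc (toℕ r′) ≡ toℕ r → P r ≡ true → P r′ ≡ true

downClosed-zero : ∀ {m} {P : Fin (suc m) → Bool} → DownClosed P → ∀ d r → toℕ r ≡ d → P r ≡ true → P zero ≡ true
downClosed-zero closed _       zero    _    Pr = Pr
downClosed-zero closed (suc d) (suc r) r≡d Pr =
  downClosed-zero closed d (inject₁ r) (trans (toℕ-inject₁ r) (suc-injective r≡d))
    (closed (suc r) (inject₁ r) (cong suc (toℕ-inject₁ r)) Pr)

downClosed⇒≡<count : ∀ {m} {P : Fin m → Bool} → DownClosed P → ∀ r → P r ≡ ⌊ toℕ r <? count P ⌋
downClosed⇒≡<count {suc m} {P} closed r with P zero in P0
... | true with r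
...   | zero   = trans P0 (sym (⌊⌋-true (0 <? suc (count (P ∘ suc))) z<s))
...   | suc r′ = trans (downClosed⇒≡<count (λ r r′ r′+1≡r → closed (suc r) (suc r′) (cong suc r′+1≡r)) r′)
                       (⌊⌋-⇔ (mk⇔ s<s s<s⁻¹) (toℕ r′ <? count (P ∘ suc)) (suc (toℕ r′) <? suc (count (P ∘ suc))))
downClosed⇒≡<count {suc m} {P} closed r | false =
  trans (P≡false r) (sym (⌊⌋-false (toℕ r <? count (P ∘ suc)) (λ r<c → n≮0 (subst (toℕ r <_) empty r<c))))
  where
  P≡false : ∀ r → P r ≡ false
  P≡false r with P r in Pr
  ... | false = refl
  ... | true  = contradiction (trans (sym (downClosed-zero closed (toℕ r) r refl Pr)) P0) λ ()
  empty : count (P ∘ suc) ≡ 0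
  empty = count-false (P ∘ suc) (P≡false ∘ suc)

sumUpTo-indicator≤ : ∀ n b (P : ℕ → Bool) → (∀ l → l < n → P l ≡ true → n ∸ l ≤ b) →
  sumUpTo (indicator ∘ P) n ≤ b
sumUpTo-indicator≤ zero    b P late = z≤n
sumUpTo-indicator≤ (suc n) b P late with P n in Pn
... | false = ≤-trans (≤-reflexive (+-identityʳ _))
                (sumUpTo-indicator≤ n b P (λ l l<n Pl → ≤-trans (∸-monoˡ-≤ l (n≤1+n n)) (late l (m<n⇒m<1+n l<n) Pl)))
... | true  = lastTrue b (late n ≤-refl Pn) (λ l l<n → late l (m<n⇒m<1+n l<n))
  where
  lastTrue : ∀ b → suc n ∸ n ≤ b → (∀ l → l < n → P l ≡ true → suc n ∸ l ≤ b) →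
             sumUpTo (indicator ∘ P) n + 1 ≤ b
  lastTrue zero    1≤0 _    = contradiction (subst (_≤ 0) (m+n∸n≡m 1 n) 1≤0) λ ()
  lastTrue (suc b) _   late = subst (_≤ suc b) (+-comm 1 _) (s≤s (sumUpTo-indicator≤ n b P
    (λ l l<n Pl → s≤s⁻¹ (subst (_≤ suc b) (+-∸-assoc 1 (<⇒≤ l<n)) (late l l<n Pl)))))

∸≡suc[∸1∸] : ∀ {i s} → s < i → i ∸ s ≡ suc (i ∸ 1 ∸ s)
∸≡suc[∸1∸] {suc i} (s≤s s≤i) = +-∸-assoc 1 s≤i

sumUpTo-indicator-reversed≡⊓ : ∀ x i → sumUpTo (λ s → indicator ⌊ i ∸ 1 ∸ s <? x ⌋) i ≡ x ⊓ i
sumUpTo-indicator-reversed≡⊓ x       zero    = sym (⊓-zeroʳ x)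
sumUpTo-indicator-reversed≡⊓ zero    (suc i) = sumUpTo-zero _ (suc i) (λ s _ → cong indicator (⌊⌋-false (i ∸ s <? 0) λ ()))
sumUpTo-indicator-reversed≡⊓ (suc x) (suc i) = begin
  sumUpTo (λ s → indicator ⌊ i ∸ s <? suc x ⌋) i + indicator ⌊ i ∸ i <? suc x ⌋
    ≡⟨ cong₂ _+_ (sumUpTo-cong i (λ s s<i → cong indicator (unshift s s<i))) (cong indicator last) ⟩
  sumUpTo (λ s → indicator ⌊ i ∸ 1 ∸ s <? x ⌋) i + 1
    ≡⟨ cong (_+ 1) (sumUpTo-indicator-reversed≡⊓ x i) ⟩
  x ⊓ i + 1
    ≡⟨ +-comm _ 1 ⟩
  suc x ⊓ suc i ∎
  where
  open ≡-Reasoning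
  unshift : ∀ s → s < i → ⌊ i ∸ s <? suc x ⌋ ≡ ⌊ i ∸ 1 ∸ s <? x ⌋
  unshift s s<i = trans (cong (λ d → ⌊ d <? suc x ⌋) (∸≡suc[∸1∸] s<i))
                        (⌊⌋-⇔ (mk⇔ s<s⁻¹ s<s) (suc (i ∸ 1 ∸ s) <? suc x) (i ∸ 1 ∸ s <? x))
  last : ⌊ i ∸ i <? suc x ⌋ ≡ true
  last = ⌊⌋-true (i ∸ i <? suc x) (subst (_< suc x) (sym (n∸n≡0 i)) z<s)

m<n∧1+m≮n⇒1+m≡n : ∀ {m n} → m < n → ¬ suc m < n → suc m ≡ n
m<n∧1+m≮n⇒1+m≡n m<n 1+m≮n = ≤-antisym m<n (≮⇒≥ 1+m≮n)

⊓≤⇒≤ : ∀ {a m i} → a ⊓ m ≤ i → i < m → a ≤ i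
⊓≤⇒≤ {a} {m} a⊓m≤i i<m with ≤-total a m
... | inj₁ a≤m = subst (_≤ _) (m≤n⇒m⊓n≡m a≤m) a⊓m≤i
... | inj₂ m≤a = contradiction (subst (_≤ _) (m≥n⇒m⊓n≡n m≤a) a⊓m≤i) (<⇒≱ i<m)

ColumnGrowth : (ℕ → ℕ) → ℕ → ℕ → ℕ → Set
ColumnGrowth g k n m = ∀ j l → k ≤ j → j < n → l < k → (g l + (j ∸ l)) ⊓ m ≤ g j

sumUpTo≤sumUpTo∸ : ∀ g k i m → ColumnGrowth g k (k + i) m → k + i ≤ m →
  sumUpTo g k ≤ sumUpTo (λ j → g j ∸ i) (k + i)
sumUpTo≤sumUpTo∸ g k i m growth k+i≤m = begin
  sumUpTo g k
    ≡⟨ sumUpTo-cong k (λ l _ → ∸+⊓ (g l)) ⟩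
  sumUpTo (λ l → (g l ∸ i) + g l ⊓ i) k
    ≡⟨ sumUpTo-+ _ _ k ⟩
  sumUpTo (λ l → g l ∸ i) k + sumUpTo (λ l → g l ⊓ i) k
    ≡⟨ cong (sumUpTo (λ l → g l ∸ i) k +_) doubleCount ⟩
  sumUpTo (λ l → g l ∸ i) k + sumUpTo (λ s → sumUpTo (λ l → indicator ⌊ i ∸ 1 ∸ s <? g l ⌋) k) i
    ≤⟨ +-monoʳ-≤ (sumUpTo (λ l → g l ∸ i) k) (sumUpTo-mono-≤ i columnBound) ⟩
  sumUpTo (λ l → g l ∸ i) k + sumUpTo (λ s → g (k + s) ∸ i) i
    ≡⟨ sumUpTo-split (λ j → g j ∸ i) k i ⟨
  sumUpTo (λ j → g j ∸ i) (k + i) ∎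
  where
  open ≤-Reasoning
  ∸+⊓ : ∀ x → x ≡ (x ∸ i) + x ⊓ i
  ∸+⊓ x = sym (trans (+-comm (x ∸ i) (x ⊓ i)) (trans (cong (_+ (x ∸ i)) (⊓-comm x i)) (m⊓n+n∸m≡n i x)))
  doubleCount : sumUpTo (λ l → g l ⊓ i) k ≡ sumUpTo (λ s → sumUpTo (λ l → indicator ⌊ i ∸ 1 ∸ s <? g l ⌋) k) i
  doubleCount = trans (sumUpTo-cong k (λ l _ → sym (sumUpTo-indicator-reversed≡⊓ (g l) i)))
                      (sumUpTo-comm (λ l s → indicator ⌊ i ∸ 1 ∸ s <? g l ⌋) k i)
  columnBound : ∀ s → s < i → sumUpTo (λ l → indicator ⌊ i ∸ 1 ∸ s <? g l ⌋) k ≤ g (k + s) ∸ i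
  columnBound s s<i = sumUpTo-indicator≤ k (g (k + s) ∸ i) (λ l → ⌊ i ∸ 1 ∸ s <? g l ⌋) late
    where
    late : ∀ l → l < k → ⌊ i ∸ 1 ∸ s <? g l ⌋ ≡ true → k ∸ l ≤ g (k + s) ∸ i
    late l l<k tall = m+n≤o⇒m≤o∸n (k ∸ l) (≤-trans (⊓-glb belowShift belowM) (growth (k + s) l (m≤m+n k s) (+-monoʳ-< k s<i) l<k))
      where
      i≤gl+s : i ≤ g l + s
      i≤gl+s = begin
        i                  ≡⟨ m∸n+n≡m (<⇒≤ s<i) ⟨
        i ∸ s + s          ≡⟨ cong (_+ s) (∸≡suc[∸1∸] s<i) ⟩
        suc (i ∸ 1 ∸ s) + s ≤⟨ +-monoˡ-≤ s (⌊⌋-true⁻¹ (i ∸ 1 ∸ s <? g l) tall) ⟩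
        g l + s            ∎
      belowShift : k ∸ l + i ≤ g l + (k + s ∸ l)
      belowShift = begin
        k ∸ l + i         ≤⟨ +-monoʳ-≤ (k ∸ l) i≤gl+s ⟩
        k ∸ l + (g l + s) ≡⟨ +-exchangeˡ (k ∸ l) (g l) s ⟩
        g l + (k ∸ l + s) ≡⟨ cong (g l +_) (+-∸-comm s (<⇒≤ l<k)) ⟨
        g l + (k + s ∸ l) ∎
      belowM : k ∸ l + i ≤ m
      belowM = ≤-trans (+-monoˡ-≤ i (m∸n≤m k l)) k+i≤m

minUpTo≡head : ∀ (f : ℕ → ℕ) n → 1 ≤ n → (∀ i → i < n → f 0 ≤ f i) → minUpTo f n ≡ f 0
minUpTo≡head f (suc zero)    _ _      = refl
minUpTo≡head f (suc (suc n)) _ f0≤fi rewrite minUpTo≡head f (suc n) (s≤s z≤n) (λ i i<n → f0≤fi i (m<n⇒m<1+n i<n)) =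
  m≤n⇒m⊓n≡m (f0≤fi (suc n) ≤-refl)

maxUpTo-≥ : ∀ (f : ℕ → ℕ) n l → l < n → f l ≤ maxUpTo f n
maxUpTo-≥ f (suc n) l (s≤s l≤n) with m≤n⇒m<n∨m≡n l≤n
... | inj₁ l<n  = ≤-trans (maxUpTo-≥ f n l l<n) (m≤m⊔n _ _)
... | inj₂ refl = m≤n⊔m _ _

countDots≡sum-count : ∀ {m′ n} (D P : Fin m′ → Fin n → Bool) →
  countDots D P ≡ ℕΣ.sum (λ c → count (λ r → D r c ∧ P r c))
countDots≡sum-count {zero}   {n} D P = sym (ℕΣ.sum-replicate-zero n)
countDots≡sum-count {suc m′} {n} D P = begin
  count (λ c → D zero c ∧ P zero c) + countDots (D ∘ suc) (P ∘ suc)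
    ≡⟨ cong₂ _+_ (count≡sum (λ c → D zero c ∧ P zero c)) (countDots≡sum-count (D ∘ suc) (P ∘ suc)) ⟩
  ℕΣ.sum (λ c → indicator (D zero c ∧ P zero c)) + ℕΣ.sum (λ c → count (λ r → D (suc r) c ∧ P (suc r) c))
    ≡⟨ ℕΣ.∑-distrib-+ {n} (λ c → indicator (D zero c ∧ P zero c)) (λ c → count (λ r → D (suc r) c ∧ P (suc r) c)) ⟨
  ℕΣ.sum (λ c → count (λ r → D r c ∧ P r c)) ∎
  where open ≡-Reasoning

module FerrersDiagram {m′ n} (D : Fin m′ → Fin n → Bool) (ferrers : IsFerrers D) where

  γ-column : ∀ c → γ D (toℕ c) ≡ count (λ r → D r c)
  γ-column c = begin
    countDots D (λ _ c′ → ⌊ toℕ c′ ≟ toℕ c ⌋)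
      ≡⟨ countDots≡sum-count D _ ⟩
    ℕΣ.sum (λ c′ → count (λ r → D r c′ ∧ ⌊ toℕ c′ ≟ toℕ c ⌋))
      ≡⟨ ℕΣ-sum-single _ c otherColumn ⟩
    count (λ r → D r c ∧ ⌊ toℕ c ≟ toℕ c ⌋)
      ≡⟨ count-cong (λ r → trans (cong (D r c ∧_) (⌊⌋-true (toℕ c ≟ toℕ c) refl)) (∧-identityʳ _)) ⟩
    count (λ r → D r c) ∎
    where
    open ≡-Reasoning
    otherColumn : ∀ c′ → c′ ≢ c → count (λ r → D r c′ ∧ ⌊ toℕ c′ ≟ toℕ c ⌋) ≡ 0
    otherColumn c′ c′≢c = count-false _ λ r →
      trans (cong (D r c′ ∧_) (⌊⌋-false (toℕ c′ ≟ toℕ c) (c′≢c ∘ toℕ-injective))) (∧-zeroʳ _)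

  D≡r<γ : ∀ r c → D r c ≡ ⌊ toℕ r <? γ D (toℕ c) ⌋
  D≡r<γ r c rewrite γ-column c = downClosed⇒≡<count (λ r r′ → proj₁ ferrers r r′ c) r

  γ≤r-outside : ∀ r c → D r c ≡ false → γ D (toℕ c) ≤ toℕ r
  γ≤r-outside r c outside = ≮⇒≥ λ r<γ →
    contradiction (trans (sym outside) (trans (D≡r<γ r c) (⌊⌋-true (toℕ r <? γ D (toℕ c)) r<γ))) λ ()

  γ≤height : ∀ j → j < n → γ D j ≤ m′
  γ≤height j j<n = subst (_≤ m′) (cong (γ D) (toℕ-fromℕ< j<n))
    (subst (_≤ m′) (sym (γ-column (fromℕ< j<n))) (count≤ _))

  γ≡height : ∀ j → suc j ≡ n → γ D j ≡ m′
  γ≡height j j+1≡n = trans (cong (γ D) (sym (toℕ-fromℕ< j<n))) (trans (γ-column (fromℕ< j<n))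
    (count-true _ (λ r → proj₂ (proj₂ (proj₂ ferrers)) r (fromℕ< j<n) (trans (cong suc (toℕ-fromℕ< j<n)) j+1≡n))))
    where
    j<n : j < n
    j<n = ≤-reflexive j+1≡n

  v≡sumUpTo : ∀ δ i → v D δ i ≡ sumUpTo (λ j → γ D j ∸ i) (n ∸ (δ ∸ 1 ∸ i))
  v≡sumUpTo δ i = begin
    v D δ i                       ≡⟨ countDots≡sum-count D _ ⟩
    ℕΣ.sum {n} (λ c → count (λ r → D r c ∧ (⌊ i ≤? toℕ r ⌋ ∧ ⌊ toℕ c <? w ⌋)))
                                  ≡⟨ ℕΣ.sum-cong-≗ {n} column ⟩
    ℕΣ.sum {n} (trimmed ∘ toℕ)    ≡⟨ sumUpTo≡sum trimmed n ⟨
    sumUpTo trimmed n             ≡⟨ sumUpTo-restrict (λ j → γ D j ∸ i) (m∸n≤m n (δ ∸ 1 ∸ i)) ⟩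
    sumUpTo (λ j → γ D j ∸ i) w   ∎
    where
    open ≡-Reasoning
    w : ℕ
    w = n ∸ (δ ∸ 1 ∸ i)
    trimmed : ℕ → ℕ
    trimmed j = if ⌊ j <? w ⌋ then γ D j ∸ i else 0
    column : ∀ c → count (λ r → D r c ∧ (⌊ i ≤? toℕ r ⌋ ∧ ⌊ toℕ c <? w ⌋)) ≡ trimmed (toℕ c)
    column c with toℕ c <? w
    ... | no  _ = count-false _ (λ r → trans (cong (D r c ∧_) (∧-zeroʳ _)) (∧-zeroʳ _))
    ... | yes _ = trans (count-cong (λ r → trans (cong (D r c ∧_) (∧-identityʳ _)) (cong (_∧ ⌊ i ≤? toℕ r ⌋) (D≡r<γ r c))))
                        (count-interval i (γ D (toℕ c)) (γ≤height (toℕ c) (toℕ<n c)))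

optimality : ∀ {m′ n} (D : Fin m′ → Fin n → Bool) → IsFerrers D → ∀ {m δ k} →
  1 ≤ δ → k + (δ ∸ 1) ≡ n → n ≤ m → ColumnGrowth (γ D) k n m →
  sumUpTo (γ D) k ≡ minUpTo (v D δ) δ
optimality {n = n} D ferrers {m} {δ} {k} 1≤δ k+δ∸1≡n n≤m growth =
  sym (trans (minUpTo≡head (v D δ) δ 1≤δ v₀≤vᵢ) v₀≡)
  where
  open FerrersDiagram D ferrers
  k+i≤n : ∀ {i} → i < δ → k + i ≤ n
  k+i≤n i<δ = ≤-trans (+-monoʳ-≤ k (<⇒≤pred i<δ)) (≤-reflexive k+δ∸1≡n)
  vᵢ≡ : ∀ i → i < δ → v D δ i ≡ sumUpTo (λ j → γ D j ∸ i) (k + i)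
  vᵢ≡ i i<δ = trans (v≡sumUpTo δ i) (cong (sumUpTo (λ j → γ D j ∸ i)) width)
    where
    width : n ∸ (δ ∸ 1 ∸ i) ≡ k + i
    width = begin
      n ∸ (δ ∸ 1 ∸ i)             ≡⟨ cong (_∸ (δ ∸ 1 ∸ i)) k+δ∸1≡n ⟨
      k + (δ ∸ 1) ∸ (δ ∸ 1 ∸ i)   ≡⟨ +-∸-assoc k (m∸n≤m (δ ∸ 1) i) ⟩
      k + (δ ∸ 1 ∸ (δ ∸ 1 ∸ i))   ≡⟨ cong (k +_) (m∸[m∸n]≡n (<⇒≤pred i<δ)) ⟩
      k + i                       ∎
      where open ≡-Reasoning
  v₀≡ : v D δ 0 ≡ sumUpTo (γ D) k
  v₀≡ = trans (vᵢ≡ 0 1≤δ) (cong (sumUpTo (γ D)) (+-identityʳ k))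
  v₀≤vᵢ : ∀ i → i < δ → v D δ 0 ≤ v D δ i
  v₀≤vᵢ i i<δ = subst₂ _≤_ (sym v₀≡) (sym (vᵢ≡ i i<δ)) (sumUpTo≤sumUpTo∸ (γ D) k i m
    (λ j l k≤j j<k+i → growth j l k≤j (≤-trans j<k+i (k+i≤n i<δ))) (≤-trans (k+i≤n i<δ) n≤m))

module PowerBasis (K L : Field) (E : Embedding K L) (m : ℕ) (β : Field.Carrier L)
                  (powerBasis : Ext.IsPowerBasis K L E β m) where
  private
    module K = Field K
    module L = Field L
    module Kᴾ = FieldProperties K
    module Lᴾ = FieldProperties L
  open Embedding E
  open LinAlg L using (∑; pow)

  ι-∑ : ∀ {n} (f : Fin n → K.Carrier) → ι (LinAlg.∑ K f) ≡ ∑ (ι ∘ f)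
  ι-∑ {zero}  f = ι-0
  ι-∑ {suc n} f = trans (ι-+ _ _) (cong (ι (f zero) L.+_) (ι-∑ (f ∘ suc)))

  pow-+ : ∀ x t e → pow x t L.* pow x e ≡ pow x (t + e)
  pow-+ x zero    e = L.*-identityˡ _
  pow-+ x (suc t) e = trans (L.*-assoc x _ _) (cong (x L.*_) (pow-+ x t e))

  expand : (Fin m → K.Carrier) → L.Carrier
  expand c = ∑ (λ i → ι (c i) L.* pow β (toℕ i))

  coord : L.Carrier → Fin m → K.Carrier
  coord x = proj₁ (proj₂ powerBasis x)

  expand-coord : ∀ x → expand (coord x) ≡ x
  expand-coord x = sym (proj₂ (proj₂ powerBasis x))

  expand-+ : ∀ c d → expand (λ i → c i K.+ d i) ≡ expand c L.+ expand d
  expand-+ c d = trans (Lᴾ.∑-cong (λ i → trans (cong (L._* pow β (toℕ i)) (ι-+ (c i) (d i))) (L.distribʳ _ _ _)))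
                       (Lᴾ.∑-+ (λ i → ι (c i) L.* pow β (toℕ i)) (λ i → ι (d i) L.* pow β (toℕ i)))

  expand-injective : ∀ c d → expand c ≡ expand d → ∀ i → c i ≡ d i
  expand-injective c d c≡d i = Kᴾ.x-y≡0⇒x≡y (c i) (d i) (proj₁ powerBasis c-d expand[c-d]≡0 i)
    where
    c-d : Fin m → K.Carrier
    c-d i = c i K.+ K.- d i
    expand[c-d]≡0 : expand c-d ≡ L.0#
    expand[c-d]≡0 = Lᴾ.+-cancelʳ (expand d) (expand c-d) L.0# (begin
      expand c-d L.+ expand d          ≡⟨ expand-+ c-d d ⟨
      expand (λ i → c-d i K.+ d i)     ≡⟨ Lᴾ.∑-cong (λ i → cong (λ a → ι a L.* pow β (toℕ i)) (cancel i)) ⟩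
      expand c                         ≡⟨ c≡d ⟩
      expand d                         ≡⟨ L.+-identityˡ (expand d) ⟨
      L.0# L.+ expand d                ∎)
      where
      open ≡-Reasoning
      cancel : ∀ i → c-d i K.+ d i ≡ c i
      cancel i = trans (K.+-assoc _ _ _) (trans (cong (c i K.+_) (K.-‿inverseˡ (d i))) (Kᴾ.+-identityʳ (c i)))

  coord-unique : ∀ {x} c → x ≡ expand c → ∀ i → coord x i ≡ c i
  coord-unique {x} c x≡ = expand-injective (coord x) c (trans (expand-coord x) x≡)

  coord-0# : ∀ i → coord L.0# i ≡ K.0#
  coord-0# = coord-unique (λ _ → K.0#)
    (sym (Lᴾ.∑-zero {m} _ (λ i → trans (cong (L._* pow β (toℕ i)) ι-0) (Lᴾ.zeroˡ (pow β (toℕ i))))))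

  coord-linear : ∀ {n} (c : Fin n → K.Carrier) (x : Fin n → L.Carrier) i →
    coord (∑ (λ l → ι (c l) L.* x l)) i ≡ LinAlg.∑ K (λ l → c l K.* coord (x l) i)
  coord-linear {n} c x = coord-unique _ (sym (begin
    expand (λ i → LinAlg.∑ K (λ l → c l K.* coord (x l) i))
      ≡⟨ Lᴾ.∑-cong (λ i → trans (cong (L._* p i) (ι-∑ {n} _)) (Lᴾ.∑-*ʳ {n} (p i) _)) ⟩
    ∑ (λ i → ∑ {n} (λ l → ι (c l K.* coord (x l) i) L.* p i))
      ≡⟨ Lᴾ.∑-cong (λ i → Lᴾ.∑-cong {n} (λ l → trans (cong (L._* p i) (ι-* _ _)) (L.*-assoc _ _ _))) ⟩
    ∑ (λ i → ∑ {n} (λ l → ι (c l) L.* (ι (coord (x l) i) L.* p i)))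
      ≡⟨ Lᴾ.∑-comm (λ i l → ι (c l) L.* (ι (coord (x l) i) L.* p i)) ⟩
    ∑ {n} (λ l → ∑ (λ i → ι (c l) L.* (ι (coord (x l) i) L.* p i)))
      ≡⟨ Lᴾ.∑-cong {n} (λ l → trans (sym (Lᴾ.∑-*ˡ {m} (ι (c l)) _)) (cong (ι (c l) L.*_) (expand-coord (x l)))) ⟩
    ∑ (λ l → ι (c l) L.* x l) ∎))
    where
    open ≡-Reasoning
    p : Fin m → L.Carrier
    p i = pow β (toℕ i)

  coord-monomial : ∀ a {e} → e < m → ∀ i →
    (toℕ i ≡ e → coord (ι a L.* pow β e) i ≡ a) × (toℕ i ≢ e → coord (ι a L.* pow β e) i ≡ K.0#)
  coord-monomial a {e} e<m i = (λ i≡e → trans (coord-unique c monomial i) (on i i≡e))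
                             , (λ i≢e → trans (coord-unique c monomial i) (off i i≢e))
    where
    c : Fin m → K.Carrier
    c i = if ⌊ toℕ i ≟ e ⌋ then a else K.0#
    on : ∀ i → toℕ i ≡ e → c i ≡ a
    on i i≡e = cong (if_then a else K.0#) (⌊⌋-true (toℕ i ≟ e) i≡e)
    off : ∀ i → toℕ i ≢ e → c i ≡ K.0#
    off i i≢e = cong (if_then a else K.0#) (⌊⌋-false (toℕ i ≟ e) i≢e)
    toℕ-e : toℕ (fromℕ< e<m) ≡ e
    toℕ-e = toℕ-fromℕ< e<m
    vanishes : ∀ i → i ≢ fromℕ< e<m → ι (c i) L.* pow β (toℕ i) ≡ L.0#
    vanishes i i≢e = trans (cong (λ a → ι a L.* pow β (toℕ i)) (off i λ i≡e → i≢e (toℕ-injective (trans i≡e (sym toℕ-e)))))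
                           (trans (cong (L._* pow β (toℕ i)) ι-0) (Lᴾ.zeroˡ _))
    monomial : ι a L.* pow β e ≡ expand c
    monomial = sym (begin
      expand c                                   ≡⟨ Lᴾ.∑-single _ (fromℕ< e<m) vanishes ⟩
      ι (c (fromℕ< e<m)) L.* pow β (toℕ (fromℕ< e<m)) ≡⟨ cong₂ (λ a t → ι a L.* pow β t) (on _ toℕ-e) toℕ-e ⟩
      ι a L.* pow β e                            ∎)
      where open ≡-Reasoning

-- Fin (sumUpTo g k) enumerates the pairs (i , t) with i < k and t < g i.
module Staircase (g : ℕ → ℕ) where

  cell : ∀ k → Fin (sumUpTo g k) → ℕ × ℕ
  cell (suc k) l = [ cell k , (λ t → k , toℕ t) ]′ (splitAt (sumUpTo g k) l)

  cell-row< : ∀ k l → proj₁ (cell k l) < k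
  cell-row< (suc k) l with splitAt (sumUpTo g k) l
  ... | inj₁ l′ = m<n⇒m<1+n (cell-row< k l′)
  ... | inj₂ t  = ≤-refl

  cell-col< : ∀ k l → proj₂ (cell k l) < g (proj₁ (cell k l))
  cell-col< (suc k) l with splitAt (sumUpTo g k) l
  ... | inj₁ l′ = cell-col< k l′
  ... | inj₂ t  = toℕ<n t

  cell-injective : ∀ k l l′ → cell k l ≡ cell k l′ → l ≡ l′
  cell-injective (suc k) l l′ eq with splitAt (sumUpTo g k) l in split | splitAt (sumUpTo g k) l′ in split′
  ... | inj₁ a | inj₁ b =
    trans (sym (splitAt⁻¹-↑ˡ split)) (trans (cong (_↑ˡ g k) (cell-injective k a b eq)) (splitAt⁻¹-↑ˡ split′))
  ... | inj₂ a | inj₂ b =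
    trans (sym (splitAt⁻¹-↑ʳ split)) (trans (cong (sumUpTo g k ↑ʳ_) (toℕ-injective (cong proj₂ eq))) (splitAt⁻¹-↑ʳ split′))
  ... | inj₁ a | inj₂ b = contradiction (cong proj₁ eq) (<⇒≢ (cell-row< k a))
  ... | inj₂ a | inj₁ b = contradiction (cong proj₁ eq) (>⇒≢ (cell-row< k b))

-- The truncation at m is harmless: when γ_i + e ≥ m, column j is full.
MonomialEntriesFit : (K L : Field) → Embedding K L → ℕ → Field.Carrier L →
  ∀ {k n m′} → Matrix L k n → (Fin m′ → Fin n → Bool) → Set
MonomialEntriesFit K L E m β {k} G D = ∀ i j → k ≤ toℕ j →
  Σ (Field.Carrier K) λ a → Σ ℕ λ e →
    G i j ≡ Field._*_ L (Embedding.ι E a) (LinAlg.pow L β e) × (γ D (toℕ i) + e) ⊓ m ≤ γ D (toℕ j)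

module FerrersCodeConstruction
  (K L : Field) (E : Embedding K L) (m : ℕ) (β : Field.Carrier L)
  (powerBasis : Ext.IsPowerBasis K L E β m)
  {k n δ : ℕ} (G : Matrix L k n)
  (systematic : Ext.IsSystematic K L E G)
  (mrd : Ext.IsMRDGenerator K L E m β G δ)
  {m′ : ℕ} (D : Fin m′ → Fin n → Bool) (ferrers : IsFerrers D)
  (k≤n : k ≤ n) (m′≤m : m′ ≤ m)
  (fits : MonomialEntriesFit K L E m β G D)
  where

  private
    module K = Field K
    module L = Field L
    module Kᴾ = FieldProperties K
    module Lᴾ = FieldProperties L
    module KA = LinAlg K
  open Embedding E
  open LinAlg L using (∑; pow)
  open Ext K L E using (codeword)
  open PowerBasis K L E m β powerBasis
  open FerrersDiagram D ferrers
  open Staircase (γ D)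

  dim : ℕ
  dim = sumUpTo (γ D) k

  row : Fin dim → Fin k
  row l = fromℕ< (cell-row< k l)

  shift : Fin dim → ℕ
  shift l = proj₂ (cell k l)

  toℕ-row : ∀ l → toℕ (row l) ≡ proj₁ (cell k l)
  toℕ-row l = toℕ-fromℕ< (cell-row< k l)

  shift<γ : ∀ l → shift l < γ D (toℕ (row l))
  shift<γ l = subst (λ i → shift l < γ D i) (sym (toℕ-row l)) (cell-col< k l)

  shift<m′ : ∀ l → shift l < m′
  shift<m′ l = ≤-trans (shift<γ l) (γ≤height _ (≤-trans (toℕ<n (row l)) k≤n))

  row,shift-injective : ∀ {l l′} → row l ≡ row l′ → shift l ≡ shift l′ → l ≡ l′
  row,shift-injective {l} {l′} row≡ shift≡ =
    cell-injective k l l′ (cong₂ _,_ (trans (sym (toℕ-row l)) (trans (cong toℕ row≡) (toℕ-row l′))) shift≡)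

  shiftedRow : Fin dim → Fin n → L.Carrier
  shiftedRow l j = pow β (shift l) L.* G (row l) j

  embedRow : Fin m′ → Fin m
  embedRow r = inject≤ r m′≤m

  basis : Fin dim → Matrix K m′ n
  basis l r j = coord (shiftedRow l j) (embedRow r)

  shift<m : ∀ l → shift l < m
  shift<m l = ≤-trans (shift<m′ l) m′≤m

  shiftedRow-pivot : ∀ l j → toℕ j ≡ toℕ (row l) → shiftedRow l j ≡ ι K.1# L.* pow β (shift l)
  shiftedRow-pivot l j j≡row = begin
    pow β (shift l) L.* G (row l) j  ≡⟨ cong (pow β (shift l) L.*_) (proj₁ (systematic (row l) j j<k) j≡row) ⟩
    pow β (shift l) L.* L.1#         ≡⟨ L.*-comm _ L.1# ⟩
    L.1# L.* pow β (shift l)         ≡⟨ cong (L._* pow β (shift l)) ι-1 ⟨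
    ι K.1# L.* pow β (shift l)       ∎
    where
    open ≡-Reasoning
    j<k : toℕ j < k
    j<k = subst (_< k) (sym j≡row) (toℕ<n (row l))

  coord-shiftedRow-pivot : ∀ l j i → toℕ j ≡ toℕ (row l) → toℕ i ≡ shift l → coord (shiftedRow l j) i ≡ K.1#
  coord-shiftedRow-pivot l j i j≡row i≡shift =
    trans (cong (λ x → coord x i) (shiftedRow-pivot l j j≡row)) (proj₁ (coord-monomial K.1# (shift<m l) i) i≡shift)

  coord-shiftedRow-offPivot : ∀ l j i → toℕ j < k → ¬ (toℕ j ≡ toℕ (row l) × toℕ i ≡ shift l) →
    coord (shiftedRow l j) i ≡ K.0#
  coord-shiftedRow-offPivot l j i j<k notPivot with toℕ j ≟ toℕ (row l)
  ... | yes j≡row = trans (cong (λ x → coord x i) (shiftedRow-pivot l j j≡row))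
                          (proj₂ (coord-monomial K.1# (shift<m l) i) (λ i≡shift → notPivot (j≡row , i≡shift)))
  ... | no  j≢row = trans (cong (λ x → coord x i) (trans (cong (pow β (shift l) L.*_) (proj₂ (systematic (row l) j j<k) j≢row))
                                                        (Lᴾ.zeroʳ _)))
                          (coord-0# i)

  coord-shiftedRow-outside : ∀ l j i → γ D (toℕ j) ≤ toℕ i → coord (shiftedRow l j) i ≡ K.0#
  coord-shiftedRow-outside l j i γ≤i with toℕ j <? k
  ... | yes j<k = coord-shiftedRow-offPivot l j i j<k λ (j≡row , i≡shift) →
                    <⇒≱ (shift<γ l) (subst₂ (λ a b → γ D a ≤ b) j≡row i≡shift γ≤i)
  ... | no  j≮k with fits (row l) j (≮⇒≥ j≮k)
  ...   | a , e , G≡ , fit = trans (cong (λ x → coord x i) monomial)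
                                   (proj₂ (coord-monomial a (<-trans below (toℕ<n i)) i) (≢-sym (<⇒≢ below)))
    where
    below : shift l + e < toℕ i
    below = ≤-trans (+-monoˡ-< e (shift<γ l)) (⊓≤⇒≤ (≤-trans fit γ≤i) (toℕ<n i))
    monomial : shiftedRow l j ≡ ι a L.* pow β (shift l + e)
    monomial = begin
      pow β (shift l) L.* G (row l) j               ≡⟨ cong (pow β (shift l) L.*_) G≡ ⟩
      pow β (shift l) L.* (ι a L.* pow β e)         ≡⟨ L.*-assoc _ _ _ ⟨
      (pow β (shift l) L.* ι a) L.* pow β e         ≡⟨ cong (L._* pow β e) (L.*-comm _ _) ⟩
      (ι a L.* pow β (shift l)) L.* pow β e         ≡⟨ L.*-assoc _ _ _ ⟩
      ι a L.* (pow β (shift l) L.* pow β e)         ≡⟨ cong (ι a L.*_) (pow-+ β (shift l) e) ⟩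
      ι a L.* pow β (shift l + e)                   ∎
      where open ≡-Reasoning

  basis-independent : (c : Fin dim → K.Carrier) → KA.IsZeroMatrix (KA.combo c basis) → ∀ l → c l ≡ K.0#
  basis-independent c combo≡0 l₀ = trans (sym combo-at-pivot) (combo≡0 r₀ j₀)
    where
    open ≡-Reasoning
    r₀ : Fin m′
    r₀ = fromℕ< (shift<m′ l₀)
    j₀ : Fin n
    j₀ = inject≤ (row l₀) k≤n
    toℕ-r₀ : toℕ (embedRow r₀) ≡ shift l₀
    toℕ-r₀ = trans (toℕ-inject≤ r₀ m′≤m) (toℕ-fromℕ< (shift<m′ l₀))
    toℕ-j₀ : toℕ j₀ ≡ toℕ (row l₀)
    toℕ-j₀ = toℕ-inject≤ (row l₀) k≤n
    offPivot : ∀ l → l ≢ l₀ → c l K.* basis l r₀ j₀ ≡ K.0#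
    offPivot l l≢l₀ = trans (cong (c l K.*_) (coord-shiftedRow-offPivot l j₀ (embedRow r₀) j₀<k notPivot)) (Kᴾ.zeroʳ (c l))
      where
      j₀<k : toℕ j₀ < k
      j₀<k = subst (_< k) (sym toℕ-j₀) (toℕ<n (row l₀))
      notPivot : ¬ (toℕ j₀ ≡ toℕ (row l) × toℕ (embedRow r₀) ≡ shift l)
      notPivot (j₀≡row , r₀≡shift) =
        l≢l₀ (row,shift-injective (toℕ-injective (trans (sym j₀≡row) toℕ-j₀)) (trans (sym r₀≡shift) toℕ-r₀))
    combo-at-pivot : KA.combo c basis r₀ j₀ ≡ c l₀
    combo-at-pivot = begin
      KA.∑ (λ l → c l K.* basis l r₀ j₀)  ≡⟨ Kᴾ.∑-single _ l₀ offPivot ⟩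
      c l₀ K.* basis l₀ r₀ j₀             ≡⟨ cong (c l₀ K.*_) (coord-shiftedRow-pivot l₀ j₀ (embedRow r₀) toℕ-j₀ toℕ-r₀) ⟩
      c l₀ K.* K.1#                       ≡⟨ Kᴾ.*-identityʳ (c l₀) ⟩
      c l₀                                ∎

  unitMessage : Fin dim → Fin k → L.Carrier
  unitMessage l i = if ⌊ i Fin.≟ row l ⌋ then pow β (shift l) else L.0#

  message : (Fin dim → K.Carrier) → Fin k → L.Carrier
  message c i = ∑ (λ l → ι (c l) L.* unitMessage l i)

  codeword-unitMessage : ∀ l j → ∑ (λ i → unitMessage l i L.* G i j) ≡ shiftedRow l j
  codeword-unitMessage l j = trans (Lᴾ.∑-single _ (row l) off) (cong (λ b → selected b L.* G (row l) j) (⌊⌋-true (row l Fin.≟ row l) refl))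
    where
    selected : Bool → L.Carrier
    selected b = if b then pow β (shift l) else L.0#
    off : ∀ i → i ≢ row l → unitMessage l i L.* G i j ≡ L.0#
    off i i≢row = trans (cong (λ b → selected b L.* G i j) (⌊⌋-false (i Fin.≟ row l) i≢row)) (Lᴾ.zeroˡ _)

  codeword-message : ∀ c j → codeword (message c) G j ≡ ∑ (λ l → ι (c l) L.* shiftedRow l j)
  codeword-message c j = begin
    ∑ (λ i → ∑ (λ l → ι (c l) L.* unitMessage l i) L.* G i j)
      ≡⟨ Lᴾ.∑-cong (λ i → trans (Lᴾ.∑-*ʳ {dim} (G i j) _) (Lᴾ.∑-cong {dim} (λ l → L.*-assoc _ _ _))) ⟩
    ∑ (λ i → ∑ (λ l → ι (c l) L.* (unitMessage l i L.* G i j)))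
      ≡⟨ Lᴾ.∑-comm (λ i l → ι (c l) L.* (unitMessage l i L.* G i j)) ⟩
    ∑ (λ l → ∑ (λ i → ι (c l) L.* (unitMessage l i L.* G i j)))
      ≡⟨ Lᴾ.∑-cong (λ l → trans (sym (Lᴾ.∑-*ˡ {k} (ι (c l)) _)) (cong (ι (c l) L.*_) (codeword-unitMessage l j))) ⟩
    ∑ (λ l → ι (c l) L.* shiftedRow l j) ∎
    where open ≡-Reasoning

  combo≡coord-codeword : ∀ c r j → KA.combo c basis r j ≡ coord (codeword (message c) G j) (embedRow r)
  combo≡coord-codeword c r j =
    sym (trans (cong (λ x → coord x (embedRow r)) (codeword-message c j)) (coord-linear c (λ l → shiftedRow l j) (embedRow r)))

  coord-codeword-outside : ∀ c j i → m′ ≤ toℕ i → coord (codeword (message c) G j) i ≡ K.0#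
  coord-codeword-outside c j i m′≤i = trans (cong (λ x → coord x i) (codeword-message c j))
    (trans (coord-linear c (λ l → shiftedRow l j) i)
      (Kᴾ.∑-zero _ (λ l → trans (cong (c l K.*_) (coord-shiftedRow-outside l j i (≤-trans (γ≤height _ (toℕ<n j)) m′≤i)))
                               (Kᴾ.zeroʳ (c l)))))

  basis-minRank : (c : Fin dim → K.Carrier) → ¬ KA.IsZeroMatrix (KA.combo c basis) →
    KA.RankAtLeast (KA.combo c basis) δ
  basis-minRank c nonzero with proj₂ (proj₂ mrd) (message c) nonzeroCodeword
    where
    nonzeroCodeword : ¬ (∀ j → codeword (message c) G j ≡ L.0#)
    nonzeroCodeword codeword≡0 = nonzero λ r j →
      trans (combo≡coord-codeword c r j) (trans (cong (λ x → coord x (embedRow r)) (codeword≡0 j)) (coord-0# (embedRow r)))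
  ... | A , Ψ[A] , rank = rankAtLeast-dropZeroRows K A (KA.combo c basis) m′≤m
          (λ r j → trans (combo≡coord-codeword c r j) (sym (A≡coord (embedRow r) j)))
          (λ i j m′≤i → trans (A≡coord i j) (coord-codeword-outside c j i m′≤i))
          rank
    where
    A≡coord : ∀ i j → A i j ≡ coord (codeword (message c) G j) i
    A≡coord i j = sym (coord-unique (λ i → A i j) (Ψ[A] j) i)

  ferrersCode : FerrersCode K D dim δ
  ferrersCode = record
    { basis    = basis
    ; support  = λ l r j outside → coord-shiftedRow-outside l j (embedRow r)
                   (subst (γ D (toℕ j) ≤_) (sym (toℕ-inject≤ r m′≤m)) (γ≤r-outside r j outside))
    ; linIndep = basis-independent
    ; minRank  = basis-minRank
    }

columnGrowth : ∀ {m′ n} (D : Fin m′ → Fin n → Bool) → IsFerrers D → ∀ m k →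
  (∀ i → k ≤ i → suc i < n → γ D i ≡ maxUpTo (λ l → γ D l + (i ∸ l)) k ⊓ m) →
  m′ ≡ ((γ D 0 + n) ⊔ maxUpTo (λ l → γ D (suc l) + (n ∸ 1 ∸ suc l)) (k ∸ 1)) ⊓ m →
  ColumnGrowth (γ D) k n m
columnGrowth {n = n} D ferrers m k inner last j l k≤j j<n l<k with suc j <? n
... | yes j+1<n = subst ((γ D l + (j ∸ l)) ⊓ m ≤_) (sym (inner j k≤j j+1<n)) (⊓-monoˡ-≤ m (maxUpTo-≥ _ k l l<k))
... | no  j+1≮n = subst ((γ D l + (j ∸ l)) ⊓ m ≤_) (sym (trans (γ≡height j j+1≡n) last)) (⊓-monoˡ-≤ m (term≤ l l<k))
  where
  open FerrersDiagram D ferrers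
  j+1≡n : suc j ≡ n
  j+1≡n = m<n∧1+m≮n⇒1+m≡n j<n j+1≮n
  term≤ : ∀ l → l < k → γ D l + (j ∸ l) ≤ (γ D 0 + n) ⊔ maxUpTo (λ l → γ D (suc l) + (n ∸ 1 ∸ suc l)) (k ∸ 1)
  term≤ zero    _     = ≤-trans (+-monoʳ-≤ (γ D 0) (<⇒≤ j<n)) (m≤m⊔n _ _)
  term≤ (suc l) l+1<k = ≤-trans (≤-reflexive (cong (λ i → γ D (suc l) + (i ∸ suc l)) (cong (_∸ 1) j+1≡n)))
                                (≤-trans (maxUpTo-≥ _ (k ∸ 1) l (<⇒≤pred l+1<k)) (m≤n⊔m _ _))

specialForm-fits : ∀ (K L : Field) (E : Embedding K L) {m β k n m′} {G : Matrix L k n} {a} →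
  (D : Fin m′ → Fin n → Bool) → IsFerrers D →
  Ext.HasSpecialForm K L E β G a → ColumnGrowth (γ D) k n m → (γ D 0 + n) ⊓ m ≤ m′ →
  MonomialEntriesFit K L E m β G D
specialForm-fits K L E {m} {β} {k} {n} {G = G} {a} D ferrers (_ , inner , corner , last) growth cornerFits i j k≤j
  with suc (toℕ j) <? n
... | yes j+1<n = a i j , toℕ j ∸ toℕ i , inner i j k≤j j+1<n , growth (toℕ j) (toℕ i) k≤j (toℕ<n j) (toℕ<n i)
... | no  j+1≮n with toℕ i ≟ 0
...   | yes i≡0 = a i j , n , corner i j j+1≡n i≡0 ,
                  subst₂ (λ t h → (γ D t + n) ⊓ m ≤ h) (sym i≡0) (sym (FerrersDiagram.γ≡height D ferrers (toℕ j) j+1≡n)) cornerFits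
  where
  j+1≡n : suc (toℕ j) ≡ n
  j+1≡n = m<n∧1+m≮n⇒1+m≡n (toℕ<n j) j+1≮n
...   | no  i≢0 = a i j , toℕ j ∸ toℕ i ,
                  subst (λ t → G i j ≡ Field._*_ L (Embedding.ι E (a i j)) (LinAlg.pow L β (t ∸ toℕ i)))
                        (sym (cong (_∸ 1) j+1≡n)) (last i j j+1≡n (n≢0⇒n>0 i≢0)) ,
                  growth (toℕ j) (toℕ i) k≤j (toℕ<n j) (toℕ<n i)
  where
  j+1≡n : suc (toℕ j) ≡ n
  j+1≡n = m<n∧1+m≮n⇒1+m≡n (toℕ<n j) j+1≮n

mainTheorem4 : (q : ℕ) → IsPrimePower q →
    (K : Field) → HasCardinality K q →
    (L : Field) → (E : Embedding K L) →
    (m n δ k : ℕ) → 1 ≤ m → 1 ≤ n → 1 ≤ δ → n ≤ m → δ ≤ n →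
    k ≡ n ∸ δ + 1 →
    k * n ∸ k * k + 2 ≤ m →
    (β : Field.Carrier L) → Ext.IsPowerBasis K L E β m →
    (G : Matrix L k n) → (a : Fin k → Fin n → Field.Carrier K) →
    Ext.HasSpecialForm K L E β G a →
    Ext.CoeffConditions K L E a →
    Ext.IsMRDGenerator K L E m β G δ →
    Ext.IsSystematic K L E G →
    (m' : ℕ) → (D : Fin m' → Fin n → Bool) → IsFerrers D →
    (∀ i → k ≤ i → suc i < n →
       γ D i ≡ maxUpTo (λ l → γ D l + (i ∸ l)) k ⊓ m) →
    m' ≡ ((γ D 0 + n) ⊔ maxUpTo (λ l → γ D (suc l) + (n ∸ 1 ∸ suc l)) (k ∸ 1)) ⊓ m →
    Σ (FerrersCode K D (sumUpTo (γ D) k) δ)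
      (λ _ → IsOptimal K D (sumUpTo (γ D) k) δ)
mainTheorem4 _ _ K _ L E m n δ k _ _ 1≤δ n≤m δ≤n k≡n∸δ+1 _ β powerBasis G _ form _ mrd systematic m′ D ferrers inner last =
  FerrersCodeConstruction.ferrersCode K L E m β powerBasis G systematic mrd D ferrers k≤n m′≤m
    (specialForm-fits K L E D ferrers form growth cornerFits)
  , optimality D ferrers 1≤δ k+δ∸1≡n n≤m growth
  where
  k+δ∸1≡n : k + (δ ∸ 1) ≡ n
  k+δ∸1≡n = begin
    k + (δ ∸ 1)             ≡⟨ cong (_+ (δ ∸ 1)) k≡n∸δ+1 ⟩
    n ∸ δ + 1 + (δ ∸ 1)     ≡⟨ +-assoc (n ∸ δ) 1 (δ ∸ 1) ⟩
    n ∸ δ + (1 + (δ ∸ 1))   ≡⟨ cong (n ∸ δ +_) (m+[n∸m]≡n 1≤δ) ⟩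
    n ∸ δ + δ               ≡⟨ m∸n+n≡m δ≤n ⟩
    n                       ∎
    where open ≡-Reasoning
  k≤n : k ≤ n
  k≤n = subst (k ≤_) k+δ∸1≡n (m≤m+n k (δ ∸ 1))
  m′≤m : m′ ≤ m
  m′≤m = subst (_≤ m) (sym last) (m⊓n≤n _ m)
  growth : ColumnGrowth (γ D) k n m
  growth = columnGrowth D ferrers m k inner last
  cornerFits : (γ D 0 + n) ⊓ m ≤ m′
  cornerFits = subst ((γ D 0 + n) ⊓ m ≤_) (sym last) (⊓-monoˡ-≤ m (m≤m⊔n _ _))
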